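{- For every integer $t>0$ let $g_t(n)=\lfloor n^{1/t}\rfloor$. Then for every $t>0$ the function $\nu_{g_t}$ eventually dominates every primitive recursive function.
   Context: A natural number $N$ is identified with $\{0,1,\dots,N-1\}$, and $[X]^2$ denotes the set of two-element subsets of $X$. For $g:\mathbb{N}\to\mathbb{N}$, a coloring $c:[N]^2\to\mathbb{N}$ is $g$-regressive if $c(\{m,n\})\le g(\min\{m,n\})$ for all pairs. A set $B\subseteq N$ is min-homogeneous for $c$ if for all $\{m,n\}\in[B]^2$ the color $c(\{m,n\})$ depends only on $\min\{m,n\}$. $N\stackrel{\min}{\longrightarrow}(k)_g$ means every $g$-regressive coloring of $[N]^2$ has a min-homogeneous set of size $k$; $\nu_g(k)$ is the least such $N$. A function $F$ eventually dominates $h$ if $F(k)>h(k)$ for all sufficiently large $k$. -}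

module Defs where

open import Data.Nat using (ℕ; zero; suc; _+_; _*_; _^_; _≤_; _<_; _≤?_)
open import Data.Fin using (Fin)
open import Data.Vec using (Vec; []; _∷_; lookup; map)
open import Data.Product using (Σ; ∃; _×_; _,_)
open import Relation.Nullary using (yes; no)
open import Relation.Binary.PropositionalEquality using (_≡_)

data PR : ℕ → Set where
  pr-zero : PR 0
  pr-succ : PR 1
  pr-proj : ∀ {n} → Fin n → PR n
  pr-comp : ∀ {k n} → PR k → Vec (PR n) k → PR n
  pr-rec  : ∀ {n} → PR n → PR (suc (suc n)) → PR (suc n)

mutual
  eval : ∀ {n} → PR n → Vec ℕ n → ℕ
  eval pr-zero      xs       = 0
  eval pr-succ      (x ∷ []) = suc x
  eval (pr-proj i)  xs       = lookup xs i
  eval (pr-comp f gs) xs     = eval f (evalAll gs xs)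
  eval (pr-rec f g) (zero  ∷ xs) = eval f xs
  eval (pr-rec f g) (suc y ∷ xs) = eval g (y ∷ eval (pr-rec f g) (y ∷ xs) ∷ xs)

  evalAll : ∀ {k n} → Vec (PR n) k → Vec ℕ n → Vec ℕ k
  evalAll []       xs = []
  evalAll (g ∷ gs) xs = eval g xs ∷ evalAll gs xs

PrimRec : (ℕ → ℕ) → Set
PrimRec h = Σ (PR 1) λ p → ∀ x → eval p (x ∷ []) ≡ h x

-- g_t(n) = ⌊ n^{1/t} ⌋ : the largest m with m ^ t ≤ n
-- (search downward from n; for t ≥ 1 the root is ≤ n)

rootSearch : ℕ → ℕ → ℕ → ℕ
rootSearch t n zero    = 0
rootSearch t n (suc m) with suc m ^ t ≤? n
... | yes _ = suc m
... | no  _ = rootSearch t n m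

g : ℕ → ℕ → ℕ
g t n = rootSearch t n n

-- Colorings of [N]^2 are given as c m n for m < n (value on {m,n}).

Regressive : (ℕ → ℕ) → ℕ → (ℕ → ℕ → ℕ) → Set
Regressive f N c = ∀ m n → m < n → n < N → c m n ≤ f m

-- b : Fin k → ℕ, strictly increasing, enumerates a k-element subset of N.
MinHomogeneous : ℕ → (ℕ → ℕ → ℕ) → (k : ℕ) → (Fin k → ℕ) → Set
MinHomogeneous N c k b =
    (∀ i → b i < N)
  × (∀ i j → Data.Fin._<_ i j → b i < b j)
  × (∀ i j l → Data.Fin._<_ i j → Data.Fin._<_ i l →
       c (b i) (b j) ≡ c (b i) (b l))

MinArrow : ℕ → ℕ → (ℕ → ℕ) → Set
MinArrow N k f = ∀ (c : ℕ → ℕ → ℕ) → Regressive f N c →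
  Σ (Fin k → ℕ) λ b → MinHomogeneous N c k b

IsNu : (ℕ → ℕ) → ℕ → ℕ → Set
IsNu f k N = MinArrow N k f × (∀ M → M < N → MinArrow M k f → Data.Empty.⊥)
  where import Data.Empty

NuEventuallyDominates : (ℕ → ℕ) → (ℕ → ℕ) → Set
NuEventuallyDominates f h =
  ∃ λ K → ∀ k → K ≤ k → Σ ℕ λ N → IsNu f k N × h k < N

module Submission where

open import Data.Nat
open import Data.Nat.Properties
open import Data.Nat.DivMod using (_%_; [m+kn]%n≡m%n; m<n⇒m%n≡m)
open import Data.Nat.GeneralisedArithmetic using (fold; fold-+)
open import Data.Product using (∃; ∃₂; _×_; _,_; proj₁; proj₂)
open import Data.Sum using (inj₁; inj₂)
open import Data.Empty using (⊥-elim)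
open import Data.Fin as Fin using (Fin; toℕ)
open import Data.Fin.Properties using (toℕ-fromℕ<; toℕ-injective; toℕ<n; any?; all?) renaming (_<?_ to _<ᶠ?_)
open import Data.Vec as Vec using (Vec; []; _∷_)
open import Data.Vec.Properties using (lookup-replicate; lookup∘tabulate)
open import Data.List as List using (List; []; _∷_)
open import Data.List.Relation.Unary.All as All using (All; []; _∷_)
open import Data.List.Relation.Unary.AllPairs using (AllPairs; []; _∷_)
open import Data.List.Relation.Unary.Any using (here; there)
open import Data.List.Membership.Propositional using (_∈_)
open import Function.Base using (_∘_; case_of_)
open import Relation.Binary.Definitions using (Monotonic₁)
open import Relation.Binary.PropositionalEquality
open import Relation.Nullary using (Dec; yes; no; ¬_)
open import Relation.Nullary.Decidable using (_×-dec_; _→-dec_; ¬?; map′; decidable-stable; toSum)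
open import Defs

-- Let R = g_{2t} and F₀ x = x + 1, F_{d+1} x = F_d^{R x + 1}(x). Since
-- x < (R x + 1)^{2t}, the levels G_d = F_{2t·d} satisfy G_d^{x+1}(x) ≤ G_{d+1}(x), and this
-- is all that is needed for every primitive recursive function to lie below some G_d.
-- Colour a pair m < n by the rung (d, j), d, j < R m, of the ladder
-- F_d^{j+1}(m) ≤ n < F_d^{j+2}(m) on which n sits (0 once n ≥ F_{R m}(m)); as (R m)² ≤ g_t(m)
-- this colouring is g_t-regressive. Along a min-homogeneous sequence the ladder levels of
-- consecutive pairs strictly decrease, so a min-homogeneous set of size 2L + 2 reaches beyond
-- F_{R L}(L), which eventually exceeds every G_d(k) with L ≈ k/2.
--
-- Given a regressive colouring c, let the ancestors of n be the greedy chain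
-- of those x < n with c(y, x) = c(y, n) for every earlier chain member y. These chains are the
-- root paths of a tree on the nodes 0, 1, … in which distinct children of p get distinct
-- colours c(p, ·) ≤ f(p), and every root path is min-homogeneous. A tree of depth at most h
-- whose nodes p have at most f(p) + 1 children, created in increasing order, has boundedly
-- many nodes: each new node spends a free slot one level up, which decreases a nested
-- recursive budget. Finally N →min (k)_f is decidable, as only finitely many colourings of
-- [N]² matter, so the least such N exists.

Monotone : (ℕ → ℕ) → Set
Monotone = Monotonic₁ _≤_ _≤_

Inflationary : (ℕ → ℕ) → Set
Inflationary f = ∀ x → x ≤ f x

-- Integer roots

rootSearch-≤ : ∀ t n m → rootSearch t n m ≤ m
rootSearch-≤ t n zero = z≤n
rootSearch-≤ t n (suc m) with suc m ^ t ≤? n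
... | yes _ = ≤-refl
... | no  _ = m≤n⇒m≤1+n (rootSearch-≤ t n m)

rootSearch-^-≤ : ∀ {t} n m → 0 < t → rootSearch t n m ^ t ≤ n
rootSearch-^-≤ {suc t} n zero _ = z≤n
rootSearch-^-≤ {t} n (suc m) 0<t with suc m ^ t ≤? n
... | yes m^t≤n = m^t≤n
... | no  _     = rootSearch-^-≤ n m 0<t

≤-rootSearch : ∀ {t n m x} → x ≤ m → x ^ t ≤ n → x ≤ rootSearch t n m
≤-rootSearch {m = zero} z≤n _ = z≤n
≤-rootSearch {t} {n} {suc m} {x} x≤1+m x^t≤n with suc m ^ t ≤? n
... | yes _ = x≤1+m
... | no 1+m^t≰n with m≤n⇒m<n∨m≡n x≤1+m
...   | inj₁ x<1+m = ≤-rootSearch (≤-pred x<1+m) x^t≤n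
...   | inj₂ refl  = ⊥-elim (1+m^t≰n x^t≤n)

m≤m^[1+n] : ∀ x t → x ≤ x ^ suc t
m≤m^[1+n] zero    t = z≤n
m≤m^[1+n] (suc x) t = m≤m*n (suc x) (suc x ^ t) {{m^n≢0 (suc x) t}}

g-≤ : ∀ t n → g t n ≤ n
g-≤ t n = rootSearch-≤ t n n

g-^-≤ : ∀ {t} n → 0 < t → g t n ^ t ≤ n
g-^-≤ n = rootSearch-^-≤ n n

≤-g : ∀ {t n} x → 0 < t → x ^ t ≤ n → x ≤ g t n
≤-g {suc t} x _ x^t≤n = ≤-rootSearch (≤-trans (m≤m^[1+n] x t) x^t≤n) x^t≤n

g-mono : ∀ {t} → 0 < t → Monotone (g t)
g-mono {t} 0<t {n} n≤n′ = ≤-g (g t n) 0<t (≤-trans (g-^-≤ n 0<t) n≤n′)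

<-suc-g-^ : ∀ {t} n → 0 < t → n < suc (g t n) ^ t
<-suc-g-^ {t} n 0<t with suc (g t n) ^ t ≤? n
... | no  ≰n = ≰⇒> ≰n
... | yes ≤n = ⊥-elim (1+n≰n (≤-g (suc (g t n)) 0<t ≤n))

g-^-≤-g : ∀ {s t} n → 0 < s → 0 < t → g (s * t) n ^ s ≤ g t n
g-^-≤-g {s} {t} n 0<s 0<t = ≤-g _ 0<t (begin
  (g (s * t) n ^ s) ^ t  ≡⟨ ^-*-assoc (g (s * t) n) s t ⟩
  g (s * t) n ^ (s * t)  ≤⟨ g-^-≤ n (*-mono-< 0<s 0<t) ⟩
  n                      ∎)
  where open ≤-Reasoning

-- Iteration and the fast-growing hierarchy

module _ {f : ℕ → ℕ} where

  fold-inflationary : Inflationary f → ∀ x n → x ≤ fold x f n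
  fold-inflationary f-infl x zero    = ≤-refl
  fold-inflationary f-infl x (suc n) = ≤-trans (fold-inflationary f-infl x n) (f-infl _)

  fold-monoˡ : Monotone f → ∀ n {x y} → x ≤ y → fold x f n ≤ fold y f n
  fold-monoˡ f-mono zero    x≤y = x≤y
  fold-monoˡ f-mono (suc n) x≤y = f-mono (fold-monoˡ f-mono n x≤y)

  fold-monoʳ : Inflationary f → ∀ x {n n′} → n ≤ n′ → fold x f n ≤ fold x f n′
  fold-monoʳ f-infl x {n} {n′} n≤n′ = begin
    fold x f n                   ≤⟨ fold-inflationary f-infl (fold x f n) (n′ ∸ n) ⟩
    fold (fold x f n) f (n′ ∸ n) ≡⟨ fold-+ x f (n′ ∸ n) ⟨
    fold x f (n′ ∸ n + n)        ≡⟨ cong (fold x f) (m∸n+n≡m n≤n′) ⟩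
    fold x f n′                  ∎
    where open ≤-Reasoning

  fold-≤-above : ∀ {f′ x} → Inflationary f → Monotone f′ → (∀ z → x ≤ z → f z ≤ f′ z) →
                 ∀ n {y} → x ≤ y → fold y f n ≤ fold y f′ n
  fold-≤-above f-infl f′-mono f≤f′ zero    x≤y = ≤-refl
  fold-≤-above f-infl f′-mono f≤f′ (suc n) {y} x≤y =
    ≤-trans (f≤f′ _ (≤-trans x≤y (fold-inflationary f-infl y n)))
            (f′-mono (fold-≤-above f-infl f′-mono f≤f′ n x≤y))

  +-≤-fold : (∀ x → x < f x) → ∀ n y → n + y ≤ fold y f n
  +-≤-fold x<f zero    y = ≤-refl
  +-≤-fold x<f (suc n) y = ≤-<-trans (+-≤-fold x<f n y) (x<f _)

fold-*-nested : ∀ x (f : ℕ → ℕ) m n → fold x f (m * n) ≡ fold x (λ z → fold z f n) m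
fold-*-nested x f zero    n = refl
fold-*-nested x f (suc m) n = begin
  fold x f (n + m * n)                   ≡⟨ fold-+ x f n ⟩
  fold (fold x f (m * n)) f n            ≡⟨ cong (λ w → fold w f n) (fold-*-nested x f m n) ⟩
  fold (fold x (λ z → fold z f n) m) f n ∎
  where open ≡-Reasoning

module Hierarchy (R : ℕ → ℕ) (R-mono : Monotone R) where

  F : ℕ → ℕ → ℕ
  F zero    x = suc x
  F (suc d) x = fold x (F d) (suc (R x))

  x<F : ∀ d x → x < F d x
  x<F zero    x = ≤-refl
  x<F (suc d) x = ≤-<-trans (fold-inflationary (λ z → <⇒≤ (x<F d z)) x (R x)) (x<F d _)

  F-inflationary : ∀ d → Inflationary (F d)
  F-inflationary d x = <⇒≤ (x<F d x)

  F-monoʳ : ∀ d → Monotone (F d)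
  F-monoʳ zero    x≤y = s≤s x≤y
  F-monoʳ (suc d) {x} {y} x≤y = begin
    fold x (F d) (suc (R x)) ≤⟨ fold-monoˡ (F-monoʳ d) (suc (R x)) x≤y ⟩
    fold y (F d) (suc (R x)) ≤⟨ fold-monoʳ (F-inflationary d) y (s≤s (R-mono x≤y)) ⟩
    fold y (F d) (suc (R y)) ∎
    where open ≤-Reasoning

  F-≤-F-suc : ∀ d x → F d x ≤ F (suc d) x
  F-≤-F-suc d x = F-monoʳ d (fold-inflationary (F-inflationary d) x (R x))

  F-monoˡ : ∀ {d d′} x → d ≤ d′ → F d x ≤ F d′ x
  F-monoˡ {d} x d≤d′ = go (≤⇒≤′ d≤d′)
    where
    go : ∀ {d′} → d ≤′ d′ → F d x ≤ F d′ x
    go ≤′-refl           = ≤-refl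
    go (≤′-step {n} d≤′) = ≤-trans (go d≤′) (F-≤-F-suc n x)

  F-mono : ∀ {d d′ x y} → d ≤ d′ → x ≤ y → F d x ≤ F d′ y
  F-mono {d′ = d′} {x} d≤d′ x≤y = ≤-trans (F-monoˡ x d≤d′) (F-monoʳ d′ x≤y)

  fold-F-^-≤ : ∀ a e {x y} → x ≤ y → fold y (F e) (suc (R x) ^ a) ≤ F (a + e) y
  fold-F-^-≤ zero    e x≤y = ≤-refl
  fold-F-^-≤ (suc a) e {x} {y} x≤y = begin
    fold y (F e) (b * b ^ a)                   ≡⟨ fold-*-nested y (F e) b (b ^ a) ⟩
    fold y (λ z → fold z (F e) (b ^ a)) b      ≤⟨ fold-≤-above (λ z → fold-inflationary (F-inflationary e) z (b ^ a))
                                                    (F-monoʳ (a + e)) (λ z x≤z → fold-F-^-≤ a e x≤z) b x≤y ⟩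
    fold y (F (a + e)) b                       ≤⟨ fold-monoʳ (F-inflationary (a + e)) y (s≤s (R-mono x≤y)) ⟩
    F (suc a + e) y                            ∎
    where
    open ≤-Reasoning
    b = suc (R x)

-- Domination of primitive recursive functions

max : ∀ {n} → Vec ℕ n → ℕ
max []       = 0
max (x ∷ xs) = x ⊔ max xs

lookup-≤-max : ∀ {n} (xs : Vec ℕ n) i → Vec.lookup xs i ≤ max xs
lookup-≤-max (x ∷ xs) Fin.zero    = m≤m⊔n x (max xs)
lookup-≤-max (x ∷ xs) (Fin.suc i) = ≤-trans (lookup-≤-max xs i) (m≤n⊔m x (max xs))

module Domination (G : ℕ → ℕ → ℕ)
                  (x<G : ∀ d x → x < G d x)
                  (G-monoʳ : ∀ d → Monotone (G d))
                  (G-monoˡ : ∀ {d d′} x → d ≤ d′ → G d x ≤ G d′ x)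
                  (fold-G-≤ : ∀ d x → fold x (G d) (suc x) ≤ G (suc d) x) where

  G-mono : ∀ {d d′ x y} → d ≤ d′ → x ≤ y → G d x ≤ G d′ y
  G-mono {d′ = d′} {x} d≤d′ x≤y = ≤-trans (G-monoˡ x d≤d′) (G-monoʳ d′ x≤y)

  G-inflationary : ∀ d → Inflationary (G d)
  G-inflationary d x = <⇒≤ (x<G d x)

  fold-G-≤-G-suc : ∀ d {n} x → n ≤ suc x → fold x (G d) n ≤ G (suc d) x
  fold-G-≤-G-suc d x n≤1+x = ≤-trans (fold-monoʳ (G-inflationary d) x n≤1+x) (fold-G-≤ d x)

  Bounded : ∀ {n} → ℕ → (Vec ℕ n → ℕ) → Set
  Bounded d f = ∀ xs → f xs < G d (suc (max xs))

  Bounded-mono : ∀ {n d d′} {f : Vec ℕ n → ℕ} → d ≤ d′ → Bounded d f → Bounded d′ f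
  Bounded-mono d≤d′ f<G xs = <-≤-trans (f<G xs) (G-monoˡ _ d≤d′)

  mutual
    eval-bounded : ∀ {n} (p : PR n) → ∃ λ d → Bounded d (eval p)
    eval-bounded pr-zero       = 0 , λ xs → <-trans z<s (x<G 0 _)
    eval-bounded pr-succ       = 0 , λ { (x ∷ []) → subst (λ z → suc x < G 0 (suc z)) (sym (⊔-identityʳ x)) (x<G 0 (suc x)) }
    eval-bounded (pr-proj i)   = 0 , λ xs → <-≤-trans (s≤s (lookup-≤-max xs i)) (G-inflationary 0 _)
    eval-bounded (pr-comp f gs) with eval-bounded f | evalAll-bounded gs
    ... | df , f<G | dg , gs<G = suc (df ⊔ dg) , λ xs → let E = df ⊔ dg ; X = suc (max xs) in begin-strict
      eval f (evalAll gs xs)           <⟨ f<G (evalAll gs xs) ⟩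
      G df (suc (max (evalAll gs xs))) ≤⟨ G-mono (m≤m⊔n df dg) (Bounded-mono (m≤n⊔m df dg) gs<G xs) ⟩
      fold X (G E) 2                   ≤⟨ fold-G-≤-G-suc E X (s≤s (s≤s z≤n)) ⟩
      G (suc E) X                      ∎
      where open ≤-Reasoning
    eval-bounded (pr-rec f g) with eval-bounded f | eval-bounded g
    ... | df , f<G | dg , g<G = suc D , λ { (y ∷ xs) →
        <-≤-trans (rec-< y xs ≤-refl) (fold-G-≤-G-suc D _ (s≤s (m≤n⇒m≤1+n (m≤m⊔n y (max xs))))) }
      where
      D = df ⊔ dg
      rec-< : ∀ y xs {M} → suc (y ⊔ max xs) ≤ M → eval (pr-rec f g) (y ∷ xs) < fold M (G D) (suc y)
      rec-< zero    xs y⊔xs<M = <-≤-trans (f<G xs) (G-mono (m≤m⊔n df dg) (≤-trans (s≤s (m≤n⊔m 0 _)) y⊔xs<M))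
      rec-< (suc y) xs {M} y⊔xs<M = <-≤-trans (g<G (y ∷ v ∷ xs)) (G-mono (m≤n⊔m df dg) (⊔-lub y<Z (⊔-lub v<Z xs<Z)))
        where
        v = eval (pr-rec f g) (y ∷ xs)
        Z = fold M (G D) (suc y)
        M≤Z : M ≤ Z
        M≤Z = fold-inflationary (G-inflationary D) M (suc y)
        v<Z : v < Z
        v<Z = rec-< y xs (≤-trans (s≤s (⊔-monoˡ-≤ (max xs) (n≤1+n y))) y⊔xs<M)
        y<Z : y < Z
        y<Z = ≤-trans (s≤s (≤-trans (n≤1+n y) (m≤m⊔n (suc y) (max xs)))) (≤-trans y⊔xs<M M≤Z)
        xs<Z : max xs < Z
        xs<Z = ≤-trans (s≤s (m≤n⊔m (suc y) (max xs))) (≤-trans y⊔xs<M M≤Z)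

    evalAll-bounded : ∀ {k n} (gs : Vec (PR n) k) → ∃ λ d → Bounded d (λ xs → max (evalAll gs xs))
    evalAll-bounded []       = 0 , λ xs → <-trans z<s (x<G 0 _)
    evalAll-bounded (g ∷ gs) with eval-bounded g | evalAll-bounded gs
    ... | d₁ , g<G | d₂ , gs<G = d₁ ⊔ d₂ , λ xs →
      ⊔-lub (Bounded-mono (m≤m⊔n d₁ d₂) g<G xs) (Bounded-mono (m≤n⊔m d₁ d₂) gs<G xs)

-- A g_t-regressive colouring without large min-homogeneous sets

bracket : (a : ℕ → ℕ) → ∀ {n} K → a 0 ≤ n → n < a K → ∃ λ e → e < K × a e ≤ n × n < a (suc e)
bracket a zero    a0≤n n<a0 = ⊥-elim (≤⇒≯ a0≤n n<a0)
bracket a {n} (suc K) a0≤n n<aK with a K ≤? n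
... | yes aK≤n = K , ≤-refl , aK≤n , n<aK
... | no  aK≰n with bracket a K a0≤n (≰⇒> aK≰n)
...   | e , e<K , ae≤n , n<ae+1 = e , m<n⇒m<1+n e<K , ae≤n , n<ae+1

%-pair : ∀ {R} .{{_ : NonZero R}} d {j} → j < R → (d * R + j) % R ≡ j
%-pair {R} d {j} j<R = begin
  (d * R + j) % R ≡⟨ cong (_% R) (+-comm (d * R) j) ⟩
  (j + d * R) % R ≡⟨ [m+kn]%n≡m%n j d R ⟩
  j % R           ≡⟨ m<n⇒m%n≡m j<R ⟩
  j               ∎
  where open ≡-Reasoning

pair-injective : ∀ {R d d′ j j′} → j < R → j′ < R → d * R + j ≡ d′ * R + j′ → d ≡ d′ × j ≡ j′
pair-injective {R} {d} {d′} {j} {j′} j<R j′<R eq = d≡d′ , j≡j′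
  where
  instance
    R≢0 : NonZero R
    R≢0 = >-nonZero (≤-<-trans z≤n j<R)
  j≡j′ : j ≡ j′
  j≡j′ = trans (sym (%-pair d j<R)) (trans (cong (_% R) eq) (%-pair d′ j′<R))
  d≡d′ : d ≡ d′
  d≡d′ = *-cancelʳ-≡ d d′ R (+-cancelʳ-≡ j (d * R) (d′ * R) (trans eq (cong (d′ * R +_) (sym j≡j′))))

pair-< : ∀ {R d j} → d < R → j < R → d * R + j < R ^ 2
pair-< {R} {d} {j} d<R j<R = begin-strict
  d * R + j  <⟨ +-monoʳ-< (d * R) j<R ⟩
  d * R + R  ≡⟨ +-comm (d * R) R ⟩
  suc d * R  ≤⟨ *-monoˡ-≤ R d<R ⟩
  R * R      ≡⟨ cong (R *_) (*-identityʳ R) ⟨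
  R ^ 2      ∎
  where open ≤-Reasoning

record MinHomogeneousSeq (N : ℕ) (c : ℕ → ℕ → ℕ) (K : ℕ) (B : ℕ → ℕ) : Set where
  field
    below      : ∀ {i} → i < K → B i < N
    increasing : ∀ {i j} → i < j → j < K → B i < B j
    min-colour : ∀ {i j l} → i < j → i < l → j < K → l < K → c (B i) (B j) ≡ c (B i) (B l)

  index-≤ : ∀ {i} → i < K → i ≤ B i
  index-≤ {zero}  _     = z≤n
  index-≤ {suc i} 1+i<K = ≤-<-trans (index-≤ (<⇒≤ 1+i<K)) (increasing ≤-refl 1+i<K)

  drop : ∀ i {K′} → i + K′ ≤ K → MinHomogeneousSeq N c K′ (λ j → B (i + j))
  drop i {K′} i+K′≤K = record
    { below      = λ j<K′ → below (shift j<K′)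
    ; increasing = λ j<l l<K′ → increasing (+-monoʳ-< i j<l) (shift l<K′)
    ; min-colour = λ j<l j<l′ l<K′ l′<K′ → min-colour (+-monoʳ-< i j<l) (+-monoʳ-< i j<l′) (shift l<K′) (shift l′<K′)
    }
    where
    shift : ∀ {j} → j < K′ → i + j < K
    shift j<K′ = <-≤-trans (+-monoʳ-< i j<K′) i+K′≤K

extend : ∀ {k} → (Fin k → ℕ) → ℕ → ℕ
extend {k} b i with i <? k
... | yes i<k = b (Fin.fromℕ< i<k)
... | no  _   = 0

extend-fromℕ< : ∀ {k} (b : Fin k → ℕ) {i} (i<k : i < k) → extend b i ≡ b (Fin.fromℕ< i<k)
extend-fromℕ< {k} b {i} i<k with i <? k
... | yes _   = refl
... | no  i≮k = ⊥-elim (i≮k i<k)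

fromℕ<-< : ∀ {k i j} (i<k : i < k) (j<k : j < k) → i < j → Fin.fromℕ< i<k Fin.< Fin.fromℕ< j<k
fromℕ<-< i<k j<k = subst₂ _<_ (sym (toℕ-fromℕ< i<k)) (sym (toℕ-fromℕ< j<k))

MinHomogeneous⇒Seq : ∀ {N c k b} → MinHomogeneous N c k b → MinHomogeneousSeq N c k (extend b)
MinHomogeneous⇒Seq {N} {c} {k} {b} (below , increasing , min-colour) = record
  { below      = λ i<k → subst (_< N) (sym (extend-fromℕ< b i<k)) (below _)
  ; increasing = λ i<j j<k → let i<k = <-trans i<j j<k in
      subst₂ _<_ (sym (extend-fromℕ< b i<k)) (sym (extend-fromℕ< b j<k))
        (increasing _ _ (fromℕ<-< i<k j<k i<j))
  ; min-colour = λ {i} {j} {l} i<j i<l j<k l<k → let i<k = <-trans i<j j<k in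
      subst₂ _≡_ (sym (cong₂ c (extend-fromℕ< b i<k) (extend-fromℕ< b j<k)))
                 (sym (cong₂ c (extend-fromℕ< b i<k) (extend-fromℕ< b l<k)))
        (min-colour _ _ _ (fromℕ<-< i<k j<k i<j) (fromℕ<-< i<k l<k i<l))
  }

module Colouring (t : ℕ) (0<t : 0 < t) where

  R : ℕ → ℕ
  R = g (2 * t)

  0<2t : 0 < 2 * t
  0<2t = *-monoʳ-< 2 0<t

  R-mono : Monotone R
  R-mono = g-mono 0<2t

  open Hierarchy R R-mono public

  Band : ℕ → ℕ → ℕ → ℕ → Set
  Band m n d j = d < R m × j < R m × fold m (F d) (suc j) ≤ n × n < F d (fold m (F d) (suc j))

  opaque
    band : ∀ {m n} → m < n → n < F (R m) m → ∃₂ (Band m n)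
    band {m} {n} m<n n<F with bracket (λ d → F d m) (R m) m<n n<F
    ... | d , d<R , Fdm≤n , n<F[1+d] with bracket (λ j → fold m (F d) (suc j)) (R m) Fdm≤n n<F[1+d]
    ...   | j , j<R , ≤n , n< = d , j , d<R , j<R , ≤n , n<

  -- 1 + d · R m + j encodes the rung (d, j) of band m<n n<F; it is at most (R m)² ≤ g t m.
  colour : ℕ → ℕ → ℕ
  colour m n with m <? n | n <? F (R m) m
  ... | yes m<n | yes n<F = let (d , j , _) = band m<n n<F in suc (d * R m + j)
  ... | _       | _       = 0

  colour-≤ : ∀ m n → colour m n ≤ g t m
  colour-≤ m n with m <? n | n <? F (R m) m
  ... | yes m<n | yes n<F = let (_ , _ , d<R , j<R , _) = band m<n n<F in
        ≤-trans (pair-< d<R j<R) (g-^-≤-g {2} m (s≤s z≤n) 0<t)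
  ... | yes _   | no  _   = z≤n
  ... | no  _   | _       = z≤n

  colour≡0 : ∀ {m n} → m < n → colour m n ≡ 0 → F (R m) m ≤ n
  colour≡0 {m} {n} m<n c≡0 with m <? n | n <? F (R m) m
  ... | yes _ | yes _   = case c≡0 of λ ()
  ... | yes _ | no  n≮F = ≮⇒≥ n≮F
  ... | no m≮n | _      = ⊥-elim (m≮n m<n)

  colour-≡ : ∀ {m n n′} → colour m n ≡ colour m n′ → colour m n ≢ 0 →
             ∃ λ d → d < R m × F d m ≤ n × n′ < F d n
  colour-≡ {m} {n} {n′} c≡c′ c≢0 with m <? n | n <? F (R m) m | m <? n′ | n′ <? F (R m) m
  ... | yes m<n | yes n<F | yes m<n′ | yes n′<F
      with band m<n n<F | band m<n′ n′<F
  ...   | d , j , d<R , j<R , ≤n , _ | d′ , j′ , _ , j′<R , _ , n′<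
      with pair-injective {d = d} {d′} j<R j′<R (suc-injective c≡c′)
  ...     | refl , refl = d , d<R , ≤-trans (fold-monoʳ (F-inflationary d) m {1} {suc j} (s≤s z≤n)) ≤n ,
                          <-≤-trans n′< (F-monoʳ d ≤n)
  colour-≡ c≡c′ c≢0 | yes _ | yes _ | yes _ | no  _ = case c≡c′ of λ ()
  colour-≡ c≡c′ c≢0 | yes _ | yes _ | no  _ | _     = case c≡c′ of λ ()
  colour-≡ c≡c′ c≢0 | yes _ | no  _ | _     | _     = ⊥-elim (c≢0 refl)
  colour-≡ c≡c′ c≢0 | no  _ | _     | _     | _     = ⊥-elim (c≢0 refl)

  -- The pair (B 1, B 2) sits on a strictly lower ladder level than (B 0, B 1): B 2 < F_d(B 1).
  level-≥ : ∀ {N} L {B} → MinHomogeneousSeq N colour (2 + L) B → colour (B 0) (B 1) ≢ 0 →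
            ∃ λ d → L ≤ d × F d (B 0) ≤ B 1
  level-≥ zero H c≢0 with colour-≡ refl c≢0
  ... | d , _ , F≤B₁ , _ = d , z≤n , F≤B₁
  level-≥ (suc L) {B} H c≢0 with colour-≡ (MinHomogeneousSeq.min-colour H z<s z<s (s<s z<s) (s<s (s<s z<s))) c≢0
  ... | d , d<R , F≤B₁ , B₂<F = d , L<d , F≤B₁
    where
    open MinHomogeneousSeq H
    B₀<B₁ : B 0 < B 1
    B₀<B₁ = increasing z<s (s<s z<s)
    B₁<B₂ : B 1 < B 2
    B₁<B₂ = increasing (s<s z<s) (s<s (s<s z<s))
    c₁₂≢0 : colour (B 1) (B 2) ≢ 0
    c₁₂≢0 c≡0 = <⇒≱ B₂<F (≤-trans (F-monoˡ (B 1) (<⇒≤ (<-≤-trans d<R (R-mono (<⇒≤ B₀<B₁)))))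
                                 (colour≡0 B₁<B₂ c≡0))
    L<d : L < d
    L<d with level-≥ L (drop 1 ≤-refl) c₁₂≢0
    ... | d′ , L≤d′ , Fd′≤B₂ =
      ≤-<-trans L≤d′ (≰⇒> λ d≤d′ → <⇒≱ B₂<F (≤-trans (F-monoˡ (B 1) d≤d′) Fd′≤B₂))

  F-R-≤-second : ∀ {N L B} → MinHomogeneousSeq N colour (2 + L) B → L ≤ B 0 → F (R L) L ≤ B 1
  F-R-≤-second {L = L} {B} H L≤B₀ with colour (B 0) (B 1) ≟ 0
  ... | yes c≡0 = ≤-trans (F-mono (R-mono L≤B₀) L≤B₀) (colour≡0 (increasing z<s (s≤s z<s)) c≡0)
    where open MinHomogeneousSeq H
  ... | no  c≢0 with level-≥ L H c≢0
  ...   | d , L≤d , F≤B₁ = ≤-trans (F-mono (≤-trans (g-≤ (2 * t) L) L≤d) L≤B₀) F≤B₁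

  F-R-<-top : ∀ {N K B} → MinHomogeneousSeq N colour K B → ∀ {L i} → L ≤ i → i + (2 + L) ≤ K →
              F (R L) L < N
  F-R-<-top {K = K} H {L} {i} L≤i i+2+L≤K =
    ≤-<-trans (F-R-≤-second (drop i i+2+L≤K) (≤-trans L≤i (≤-trans (m≤m+n i 0) (index-≤ (i+-< z<s)))))
              (below (i+-< (s≤s z<s)))
    where
    open MinHomogeneousSeq H
    i+-< : ∀ {j} → j < 2 + L → i + j < K
    i+-< j<2+L = <-≤-trans (+-monoʳ-< i j<2+L) i+2+L≤K

⌈n/2⌉≤1+⌊n/2⌋ : ∀ n → ⌈ n /2⌉ ≤ suc ⌊ n /2⌋
⌈n/2⌉≤1+⌊n/2⌋ zero          = z≤n
⌈n/2⌉≤1+⌊n/2⌋ (suc zero)    = ≤-refl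
⌈n/2⌉≤1+⌊n/2⌋ (suc (suc n)) = s≤s (⌈n/2⌉≤1+⌊n/2⌋ n)

module Growth (t : ℕ) (0<t : 0 < t) where
  open Colouring t 0<t

  G : ℕ → ℕ → ℕ
  G d = F (d * (2 * t))

  fold-G-≤ : ∀ d x → fold x (G d) (suc x) ≤ G (suc d) x
  fold-G-≤ d x = ≤-trans (fold-monoʳ (F-inflationary (d * (2 * t))) x (<-suc-g-^ x 0<2t))
                         (fold-F-^-≤ (2 * t) (d * (2 * t)) ≤-refl)

  x<G : ∀ d x → x < G d x
  x<G d = x<F (d * (2 * t))

  open Domination G x<G (λ d → F-monoʳ (d * (2 * t)))
                  (λ x d≤d′ → F-monoˡ x (*-monoˡ-≤ (2 * t) d≤d′)) fold-G-≤

  minArrow⇒F-R-< : ∀ {N} k → MinArrow N (2 + k) (g t) → F (R ⌊ k /2⌋) ⌊ k /2⌋ < N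
  minArrow⇒F-R-< k arrow with arrow colour (λ m n _ _ → colour-≤ m n)
  ... | _ , hom = F-R-<-top (MinHomogeneous⇒Seq hom) (⌊n/2⌋≤⌈n/2⌉ k) (≤-reflexive halves)
    where
    halves : ⌈ k /2⌉ + (2 + ⌊ k /2⌋) ≡ 2 + k
    halves = trans (+-comm ⌈ k /2⌉ (2 + ⌊ k /2⌋)) (cong (2 +_) (⌊n/2⌋+⌈n/2⌉≡n k))

  primRec-<-minArrow : ∀ h → PrimRec h → ∃ λ K → ∀ k → K ≤ k → ∀ N → MinArrow N k (g t) → h k < N
  primRec-<-minArrow h (p , eval≡h) with eval-bounded p
  ... | d , p<G = 2 + (L₀ + L₀) , λ { (suc (suc k)) (s≤s (s≤s L₀+L₀≤k)) N arrow → h-< k L₀+L₀≤k N arrow }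
    where
    c = suc (suc d) * (2 * t)
    L₀ = 3 + c ^ (2 * t)
    h-< : ∀ k → L₀ + L₀ ≤ k → ∀ N → MinArrow N (2 + k) (g t) → h (2 + k) < N
    h-< k L₀+L₀≤k N arrow = begin-strict
      h (2 + k)                  ≡⟨ eval≡h (2 + k) ⟨
      eval p ((2 + k) ∷ [])      <⟨ p<G ((2 + k) ∷ []) ⟩
      G d (suc (2 + k ⊔ 0))      ≡⟨ cong (λ x → G d (suc x)) (⊔-identityʳ (2 + k)) ⟩
      G d (3 + k)                ≤⟨ G-mono (n≤1+n d) (≤-trans 3+k≤ (≤-trans (+-≤-fold (x<G 0) (3 + L) (2 + L)) (fold-G-≤ 0 (2 + L)))) ⟩
      G D (G 1 (2 + L))          ≤⟨ G-mono {D} ≤-refl (G-mono {1} {D} (s≤s z≤n) (≤-trans (s≤s (x<G D L)) (x<G D (G D L)))) ⟩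
      fold L (G D) 4             ≤⟨ fold-G-≤-G-suc D L (s≤s 3≤L) ⟩
      F c L                      ≤⟨ F-monoˡ L (≤-g c 0<2t (≤-trans (m≤n+m _ 3) L₀≤L)) ⟩
      F (R L) L                  <⟨ minArrow⇒F-R-< k arrow ⟩
      N                          ∎
      where
      open ≤-Reasoning
      D = suc d
      L = ⌊ k /2⌋
      L₀≤L : L₀ ≤ L
      L₀≤L = ≤-trans (≤-reflexive (n≡⌊n+n/2⌋ L₀)) (⌊n/2⌋-mono L₀+L₀≤k)
      3≤L : 3 ≤ L
      3≤L = ≤-trans (m≤m+n 3 _) L₀≤L
      3+k≤ : 3 + k ≤ (3 + L) + (2 + L)
      3+k≤ = s≤s (s≤s (s≤s (begin
        k             ≡⟨ ⌊n/2⌋+⌈n/2⌉≡n k ⟨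
        L + ⌈ k /2⌉   ≤⟨ +-monoʳ-≤ L (≤-trans (⌈n/2⌉≤1+⌊n/2⌋ k) (n≤1+n _)) ⟩
        L + (2 + L)   ∎)))

-- The tree of greedy ancestor chains

nth : List ℕ → ℕ → ℕ
nth []       _       = 0
nth (x ∷ xs) zero    = x
nth (x ∷ xs) (suc a) = nth xs a

nth-∈ : ∀ xs {a} → a < List.length xs → nth xs a ∈ xs
nth-∈ (x ∷ xs) {zero}  _       = here refl
nth-∈ (x ∷ xs) {suc a} a<len = there (nth-∈ xs (≤-pred a<len))

nth-descending : ∀ {xs} → AllPairs _>_ xs → ∀ {a a′} → a < a′ → a′ < List.length xs → nth xs a′ < nth xs a
nth-descending {x ∷ xs} (x> ∷ _)   {zero}  {suc a′} _      a′<len = All.lookup x> (nth-∈ xs (≤-pred a′<len))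
nth-descending {x ∷ xs} (_ ∷ desc) {suc a} {suc a′} a<a′ a′<len = nth-descending desc (≤-pred a<a′) (≤-pred a′<len)

module Chains (c : ℕ → ℕ → ℕ) where

  Fits : ℕ → ℕ → List ℕ → Set
  Fits n m = All (λ x → c x m ≡ c x n)

  fits? : ∀ n m xs → Dec (Fits n m xs)
  fits? n m = All.all? (λ x → c x m ≟ c x n)

  chain : ℕ → ℕ → List ℕ
  chain n zero = []
  chain n (suc m) with fits? n m (chain n m)
  ... | yes _ = m ∷ chain n m
  ... | no  _ = chain n m

  data ChainStep (n m : ℕ) : Set where
    grow : chain n (suc m) ≡ m ∷ chain n m → Fits n m (chain n m) → ChainStep n m
    stay : chain n (suc m) ≡ chain n m → ¬ Fits n m (chain n m) → ChainStep n m

  chain-grow : ∀ {n m} → Fits n m (chain n m) → chain n (suc m) ≡ m ∷ chain n m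
  chain-grow {n} {m} fits with fits? n m (chain n m)
  ... | yes _    = refl
  ... | no ¬fits = ⊥-elim (¬fits fits)

  chain-stay : ∀ {n m} → ¬ Fits n m (chain n m) → chain n (suc m) ≡ chain n m
  chain-stay {n} {m} ¬fits with fits? n m (chain n m)
  ... | yes fits = ⊥-elim (¬fits fits)
  ... | no _     = refl

  chain-step : ∀ n m → ChainStep n m
  chain-step n m with fits? n m (chain n m)
  ... | yes fits = grow (chain-grow fits) fits
  ... | no ¬fits = stay (chain-stay ¬fits) ¬fits

  ∈chain⇒< : ∀ {n m x} → x ∈ chain n m → x < m
  ∈chain⇒< {n} {suc m} {x} x∈ with chain-step n m
  ... | stay eq _ = m<n⇒m<1+n (∈chain⇒< (subst (x ∈_) eq x∈))
  ... | grow eq _ with subst (x ∈_) eq x∈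
  ...   | here refl = ≤-refl
  ...   | there x∈′ = m<n⇒m<1+n (∈chain⇒< x∈′)

  chain-⊆-suc : ∀ {n m x} → x ∈ chain n m → x ∈ chain n (suc m)
  chain-⊆-suc {n} {m} {x} x∈ with chain-step n m
  ... | grow eq _ = subst (x ∈_) (sym eq) (there x∈)
  ... | stay eq _ = subst (x ∈_) (sym eq) x∈

  chain-⊆ : ∀ {n m m′ x} → m ≤ m′ → x ∈ chain n m → x ∈ chain n m′
  chain-⊆ {n} {m} {x = x} m≤m′ x∈ = go (≤⇒≤′ m≤m′)
    where
    go : ∀ {m′} → m ≤′ m′ → x ∈ chain n m′
    go ≤′-refl              = x∈
    go (≤′-step {m′} m≤′m′) = chain-⊆-suc {n} {m′} (go m≤′m′)

  chain-homogeneous : ∀ {n m x y} → x ∈ chain n m → y ∈ chain n m → x < y → c x y ≡ c x n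
  chain-homogeneous {n} {suc m} {x} {y} x∈ y∈ x<y with chain-step n m
  ... | stay eq _ = chain-homogeneous {n} {m} (subst (x ∈_) eq x∈) (subst (y ∈_) eq y∈) x<y
  ... | grow eq fits with subst (x ∈_) eq x∈ | subst (y ∈_) eq y∈
  ...   | here refl  | here refl  = ⊥-elim (<-irrefl refl x<y)
  ...   | here refl  | there y∈′  = ⊥-elim (<-asym x<y (∈chain⇒< {n} {m} y∈′))
  ...   | there x∈′  | here refl  = All.lookup fits x∈′
  ...   | there x∈′  | there y∈′  = chain-homogeneous {n} {m} x∈′ y∈′ x<y

  chain-descending : ∀ n m → AllPairs _>_ (chain n m)
  chain-descending n zero = []
  chain-descending n (suc m) with chain-step n m
  ... | grow eq _ = subst (AllPairs _>_) (sym eq) (All.tabulate (∈chain⇒< {n} {m}) ∷ chain-descending n m)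
  ... | stay eq _ = subst (AllPairs _>_) (sym eq) (chain-descending n m)

  chain-∷ : ∀ {n M p rest} → chain n M ≡ p ∷ rest → rest ≡ chain n p × p < M
  chain-∷ {n} {suc M} eq with chain-step n M
  ... | grow eq′ _ with trans (sym eq′) eq
  ...   | refl = refl , ≤-refl
  chain-∷ {n} {suc M} eq | stay eq′ _ with chain-∷ (trans (sym eq′) eq)
  ... | rest≡ , p<M = rest≡ , m<n⇒m<1+n p<M

  chain-stable : ∀ {n M m p rest} → chain n M ≡ p ∷ rest → p < m → m ≤ M → chain n m ≡ p ∷ rest
  chain-stable {n} {M} {m} eq p<m m≤M with m≤n⇒m<n∨m≡n m≤M
  ... | inj₂ refl = eq
  ... | inj₁ m<M with M | eq | m<M
  ...   | suc M′ | eq | s≤s m≤M′ with chain-step n M′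
  ...     | stay eq′ _ = chain-stable (trans (sym eq′) eq) p<m m≤M′
  ...     | grow eq′ _ with trans (sym eq′) eq
  ...       | refl = ⊥-elim (<⇒≱ p<m m≤M′)

  ancestors : ℕ → List ℕ
  ancestors n = chain n n

  ∈ancestors⇒< : ∀ {n x} → x ∈ ancestors n → x < n
  ∈ancestors⇒< {n} = ∈chain⇒< {n} {n}

  ancestors-homogeneous : ∀ {n x y} → x ∈ ancestors n → y ∈ ancestors n → x < y → c x y ≡ c x n
  ancestors-homogeneous {n} = chain-homogeneous {n} {n}

  ancestor-colour : ∀ {n p m x} → p ∈ ancestors n → m ≤ p → x ∈ chain n m → c x p ≡ c x n
  ancestor-colour {n} {p} {m} p∈ m≤p x∈ =
    ancestors-homogeneous (chain-⊆ {n} {m} {n} (≤-trans m≤p (<⇒≤ (∈ancestors⇒< p∈))) x∈) p∈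
      (<-≤-trans (∈chain⇒< {n} {m} x∈) m≤p)

  chain-agrees : ∀ {n p} → p ∈ ancestors n → ∀ {m} → m ≤ p → chain n m ≡ chain p m
  chain-agrees p∈ {zero} _ = refl
  chain-agrees {n} {p} p∈ {suc m} m<p with chain-agrees p∈ (<⇒≤ m<p) | chain-step n m | chain-step p m
  ... | ih | grow eqₙ _    | grow eqₚ _     = trans eqₙ (trans (cong (m ∷_) ih) (sym eqₚ))
  ... | ih | stay eqₙ _    | stay eqₚ _     = trans eqₙ (trans ih (sym eqₚ))
  ... | ih | grow _ fitsₙ  | stay _ ¬fitsₚ  = ⊥-elim (¬fitsₚ (subst (Fits p m) ih (All.tabulate λ x∈ →
    trans (All.lookup fitsₙ x∈) (sym (ancestor-colour p∈ (<⇒≤ m<p) x∈)))))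
  ... | ih | stay _ ¬fitsₙ | grow _ fitsₚ   = ⊥-elim (¬fitsₙ (All.tabulate λ {x} x∈ →
    trans (All.lookup fitsₚ (subst (x ∈_) ih x∈)) (ancestor-colour p∈ (<⇒≤ m<p) x∈)))

  0∈ancestors : ∀ {n} → 1 ≤ n → 0 ∈ ancestors n
  0∈ancestors {n} 1≤n = chain-⊆ {n} {1} {n} 1≤n (subst (0 ∈_) (sym (chain-grow {n} {0} [])) (here refl))

  parent : ℕ → ℕ
  parent n with ancestors n
  ... | []    = 0
  ... | p ∷ _ = p

  depth : ℕ → ℕ
  depth n = List.length (ancestors n)

  parent-spec : ∀ {n} → 1 ≤ n → ancestors n ≡ parent n ∷ ancestors (parent n) × parent n < n
  parent-spec {n} 1≤n with ancestors n in eq | 0∈ancestors 1≤n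
  ... | p ∷ rest | _ with chain-∷ {n} {n} eq
  ...   | rest≡ , p<n = cong (p ∷_) (trans rest≡ (chain-agrees (subst (p ∈_) (sym eq) (here refl)) ≤-refl)) , p<n

  depth-parent : ∀ {n} → 1 ≤ n → depth n ≡ suc (depth (parent n))
  depth-parent 1≤n = cong List.length (proj₁ (parent-spec 1≤n))

  parent-injective : ∀ {n n′} → 1 ≤ n → n < n′ → parent n ≡ parent n′ → c (parent n) n ≢ c (parent n) n′
  parent-injective {n} {n′} 1≤n n<n′ p≡p′ c≡c′ with parent-spec 1≤n | parent-spec (≤-trans 1≤n (<⇒≤ n<n′))
  ... | anc-n , p<n | anc-n′ , _ with chain-step n′ n
  ...   | grow eq _ with subst (n ∈_) anc-n′ (chain-⊆ {n′} {suc n} {n′} n<n′ (subst (n ∈_) (sym eq) (here refl)))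
  ...     | here n≡p    = <-irrefl (sym (trans n≡p (sym p≡p′))) p<n
  ...     | there n∈anc = <-asym p<n (subst (n <_) (sym p≡p′) (∈ancestors⇒< n∈anc))
  parent-injective {n} {n′} 1≤n n<n′ p≡p′ c≡c′ | anc-n , p<n | anc-n′ , _ | stay _ ¬fits =
    ¬fits (subst (Fits n′ n) (sym (chain-stable anc-n′ₚ p<n (<⇒≤ n<n′)))
                 (c≡c′ ∷ All.tabulate λ x∈ → trans (sym (via-p anc-n x∈)) (via-p anc-n′ₚ x∈)))
    where
    p = parent n
    anc-n′ₚ : ancestors n′ ≡ p ∷ ancestors p
    anc-n′ₚ = subst (λ q → ancestors n′ ≡ q ∷ ancestors q) (sym p≡p′) anc-n′
    via-p : ∀ {m x} → ancestors m ≡ p ∷ ancestors p → x ∈ ancestors p → c x p ≡ c x m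
    via-p {m} {x} anc-m x∈ = ancestors-homogeneous {m} (subst (x ∈_) (sym anc-m) (there x∈))
                               (subst (p ∈_) (sym anc-m) (here refl)) (∈ancestors⇒< {p} x∈)

  deep⇒minHomogeneous : ∀ {n N h} → n < N → suc h ≤ depth n → ∃ λ b → MinHomogeneous N c (2 + h) b
  deep⇒minHomogeneous {n} {N} {h} n<N h<depth = b , below , increasing , min-colour
    where
    Q = n ∷ ancestors n
    index : Fin (2 + h) → ℕ
    index i = suc h ∸ Fin.toℕ i
    index< : ∀ i → index i < List.length Q
    index< i = s≤s (≤-trans (m∸n≤m (suc h) (Fin.toℕ i)) h<depth)
    index-antitone : ∀ {i j} → i Fin.< j → index j < index i
    index-antitone {j = j} i<j = ∸-monoʳ-< i<j (≤-pred (toℕ<n j))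
    b : Fin (2 + h) → ℕ
    b i = nth Q (index i)
    Q-descending : AllPairs _>_ Q
    Q-descending = All.tabulate (∈ancestors⇒< {n}) ∷ chain-descending n n
    below : ∀ i → b i < N
    below i with nth-∈ Q (index< i)
    ... | here  bi≡n = subst (_< N) (sym bi≡n) n<N
    ... | there bi∈ = <-trans (∈ancestors⇒< {n} bi∈) n<N
    increasing : ∀ i j → i Fin.< j → b i < b j
    increasing i j i<j = nth-descending Q-descending (index-antitone i<j) (index< i)
    Q-colour : ∀ {a a′} → a′ < a → a < List.length Q → c (nth Q a) (nth Q a′) ≡ c (nth Q a) n
    Q-colour {suc a} {a′} a′<a a<len with nth-∈ Q (<-trans a′<a a<len)
    ... | here  y≡n = cong (c (nth Q (suc a))) y≡n
    ... | there y∈ = ancestors-homogeneous {n} (nth-∈ (ancestors n) (≤-pred a<len)) y∈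
                       (nth-descending Q-descending a′<a a<len)
    colour-n : ∀ {i j} → i Fin.< j → c (b i) (b j) ≡ c (b i) n
    colour-n {i} i<j = Q-colour (index-antitone i<j) (index< i)
    min-colour : ∀ i j l → i Fin.< j → i Fin.< l → c (b i) (b j) ≡ c (b i) (b l)
    min-colour i j l i<j i<l = trans (colour-n i<j) (sym (colour-n i<l))

-- Trees in which each node has few children are small

∑< : ℕ → (ℕ → ℕ) → ℕ
∑< zero    a = 0
∑< (suc n) a = ∑< n a + a n

∑<-mono : ∀ n {a b : ℕ → ℕ} → (∀ {m} → m < n → a m ≤ b m) → ∑< n a ≤ ∑< n b
∑<-mono zero    a≤b = z≤n
∑<-mono (suc n) a≤b = +-mono-≤ (∑<-mono n (a≤b ∘ m<n⇒m<1+n)) (a≤b ≤-refl)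

∑<-mono-< : ∀ n {a b : ℕ → ℕ} {q} → (∀ {m} → m < n → a m ≤ b m) → q < n → a q < b q → ∑< n a < ∑< n b
∑<-mono-< (suc n) {q = q} a≤b q<1+n aq<bq with m≤n⇒m<n∨m≡n (≤-pred q<1+n)
... | inj₂ refl = +-mono-≤-< (∑<-mono n (λ m<n → a≤b (m<n⇒m<1+n m<n))) aq<bq
... | inj₁ q<n  = +-mono-<-≤ (∑<-mono-< n (λ m<n → a≤b (m<n⇒m<1+n m<n)) q<n aq<bq) (a≤b ≤-refl)

∑<-≢0 : ∀ n {a : ℕ → ℕ} → 1 ≤ ∑< n a → ∃ λ m → m < n × 1 ≤ a m
∑<-≢0 (suc n) {a} 1≤∑ with a n ≟ 0
... | no  an≢0 = n , ≤-refl , n≢0⇒n>0 an≢0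
... | yes an≡0 with ∑<-≢0 n (subst (1 ≤_) (trans (cong (∑< n a +_) an≡0) (+-identityʳ _)) 1≤∑)
...   | m , m<n , 1≤am = m , m<n⇒m<1+n m<n , 1≤am

∑<-1 : ∀ n → ∑< n (λ _ → 1) ≡ n
∑<-1 zero    = refl
∑<-1 (suc n) = trans (cong (_+ 1) (∑<-1 n)) (+-comm n 1)

𝟙 : ∀ {P : Set} → Dec P → ℕ
𝟙 (yes _) = 1
𝟙 (no  _) = 0

𝟙-yes : ∀ {P : Set} (d : Dec P) → P → 𝟙 d ≡ 1
𝟙-yes (yes _) _ = refl
𝟙-yes (no ¬p) p = ⊥-elim (¬p p)

𝟙-no : ∀ {P : Set} (d : Dec P) → ¬ P → 𝟙 d ≡ 0
𝟙-no (yes p) ¬p = ⊥-elim (¬p p)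
𝟙-no (no _)  _  = refl

𝟙-≢0 : ∀ {P : Set} (d : Dec P) → 1 ≤ 𝟙 d → P
𝟙-≢0 (yes p) _ = p

≤-∑< : ∀ {n m} (a : ℕ → ℕ) → m < n → a m ≤ ∑< n a
≤-∑< {suc n} {m} a m<1+n with m≤n⇒m<n∨m≡n (≤-pred m<1+n)
... | inj₁ m<n  = ≤-trans (≤-∑< a m<n) (m≤m+n _ _)
... | inj₂ refl = m≤n+m _ _

addHead : ∀ {L} → ℕ → Vec ℕ L → Vec ℕ L
addHead a []       = []
addHead a (x ∷ xs) = a + x ∷ xs

spend : ∀ {L} → Fin L → ℕ → Vec ℕ L → Vec ℕ L
spend Fin.zero    a (x ∷ xs) = pred x ∷ addHead a xs
spend (Fin.suc j) a (x ∷ xs) = x ∷ spend j a xs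

lookup-spend-self : ∀ {L} j a (s : Vec ℕ L) → Vec.lookup (spend j a s) j ≡ pred (Vec.lookup s j)
lookup-spend-self Fin.zero    a (x ∷ s) = refl
lookup-spend-self (Fin.suc j) a (x ∷ s) = lookup-spend-self j a s

lookup-spend-next : ∀ {L} j i a (s : Vec ℕ L) → toℕ i ≡ suc (toℕ j) →
                    Vec.lookup (spend j a s) i ≡ a + Vec.lookup s i
lookup-spend-next Fin.zero    (Fin.suc Fin.zero) a (x ∷ y ∷ s) _ = refl
lookup-spend-next (Fin.suc j) (Fin.suc i)        a (x ∷ s)     i≡1+j = lookup-spend-next j i a s (suc-injective i≡1+j)

lookup-spend-other : ∀ {L} j i a (s : Vec ℕ L) → toℕ i ≢ toℕ j → toℕ i ≢ suc (toℕ j) →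
                     Vec.lookup (spend j a s) i ≡ Vec.lookup s i
lookup-spend-other Fin.zero    Fin.zero                 a (x ∷ s)     i≢j _    = ⊥-elim (i≢j refl)
lookup-spend-other Fin.zero    (Fin.suc Fin.zero)       a (x ∷ y ∷ s) _   i≢1  = ⊥-elim (i≢1 refl)
lookup-spend-other Fin.zero    (Fin.suc (Fin.suc i))    a (x ∷ y ∷ s) _   _    = refl
lookup-spend-other (Fin.suc j) Fin.zero                 a (x ∷ s)     _   _    = refl
lookup-spend-other (Fin.suc j) (Fin.suc i)              a (x ∷ s)     i≢j i≢1+j =
  lookup-spend-other j i a s (i≢j ∘ cong suc) (i≢1+j ∘ cong suc)

-- budget L E s n bounds the time up to which nodes can be created, starting at time n with sᵢ
-- free slots on level i; a node created at time n′ on level i + 1 spends a slot of level i and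
-- opens f n′ + 1 slots on level i + 1. The head count is consumed by recursion in budget-head,
-- and E bounds what can still happen on the levels already peeled off.
module Budget (f : ℕ → ℕ) where

  mutual
    budget : ∀ L → (Vec ℕ L → ℕ → ℕ) → Vec ℕ L → ℕ → ℕ
    budget zero    E []       n = n ⊔ E [] n
    budget (suc L) E (x ∷ xs) n = budget-head L E x xs n

    budget-head : ∀ L → (Vec ℕ (suc L) → ℕ → ℕ) → ℕ → Vec ℕ L → ℕ → ℕ
    budget-head L E zero    xs n = budget L (λ ys n′ → E (0 ∷ ys) n′) xs n
    budget-head L E (suc x) xs n =
      budget L (λ ys n′ → E (suc x ∷ ys) n′ ⊔ budget-head L E x (addHead (suc (f n′)) ys) (suc n′)) xs n

  budget-≥ : ∀ L E s n → n ⊔ E s n ≤ budget L E s n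
  budget-≥ zero    E []            n = ≤-refl
  budget-≥ (suc L) E (zero ∷ xs)   n = budget-≥ L _ xs n
  budget-≥ (suc L) E (suc x ∷ xs)  n =
    ≤-trans (⊔-monoʳ-≤ n (m≤m⊔n (E (suc x ∷ xs) n) _)) (budget-≥ L _ xs n)

  budget-spend : ∀ L E s n j → 1 ≤ Vec.lookup s j → budget L E (spend j (suc (f n)) s) (suc n) ≤ budget L E s n
  budget-spend (suc L) E (suc x ∷ xs) n Fin.zero    _ = ≤-trans (m≤n⊔m _ _) (≤-trans (m≤n⊔m n _) (budget-≥ L _ xs n))
  budget-spend (suc L) E (zero  ∷ xs) n (Fin.suc j) 1≤ = budget-spend L _ xs n j 1≤
  budget-spend (suc L) E (suc x ∷ xs) n (Fin.suc j) 1≤ = budget-spend L _ xs n j 1≤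

module Forest (f : ℕ → ℕ) (c : ℕ → ℕ → ℕ) (N : ℕ) (reg : Regressive f N c) where
  open Chains c

  IsChild : ℕ → ℕ → Set
  IsChild p m = parent m ≡ p × 1 ≤ m

  child? : ∀ p m → Dec (IsChild p m)
  child? p m = (parent m ≟ p) ×-dec (1 ≤? m)

  children : ℕ → ℕ → ℕ
  children p n = ∑< n (λ m → 𝟙 (child? p m))

  childrenOfColour : ℕ → ℕ → ℕ → ℕ
  childrenOfColour p n v = ∑< n (λ m → 𝟙 (child? p m ×-dec (c p m ≟ v)))

  childrenOfColour-≤1 : ∀ p n v → childrenOfColour p n v ≤ 1
  childrenOfColour-≤1 p zero    v = z≤n
  childrenOfColour-≤1 p (suc n) v with child? p n ×-dec (c p n ≟ v)
  ... | no  _ = subst (_≤ 1) (sym (+-identityʳ _)) (childrenOfColour-≤1 p n v)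
  ... | yes ((parent≡p , 1≤n) , colour≡v) with childrenOfColour p n v ≟ 0
  ...   | yes ≡0 = subst (λ k → k + 1 ≤ 1) (sym ≡0) ≤-refl
  ...   | no  ≢0 with ∑<-≢0 n (n≢0⇒n>0 ≢0)
  ...     | m , m<n , 1≤ with 𝟙-≢0 (child? p m ×-dec (c p m ≟ v)) 1≤
  ...       | (parent≡p′ , 1≤m) , colour≡v′ = ⊥-elim (parent-injective 1≤m m<n (trans parent≡p′ (sym parent≡p))
                                                 (subst (λ q → c q m ≡ c q n) (sym parent≡p′) (trans colour≡v′ (sym colour≡v))))

  children-≤-colours : ∀ p n → n ≤ N → children p n ≤ ∑< (suc (f p)) (childrenOfColour p n)
  children-≤-colours p zero    _     = z≤n
  children-≤-colours p (suc n) 1+n≤N with toSum (child? p n)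
  ... | inj₂ ¬child = begin
    children p n + 𝟙 (child? p n)                   ≡⟨ cong (children p n +_) (𝟙-no (child? p n) ¬child) ⟩
    children p n + 0                                ≡⟨ +-identityʳ _ ⟩
    children p n                                    ≤⟨ children-≤-colours p n (<⇒≤ 1+n≤N) ⟩
    ∑< (suc (f p)) (childrenOfColour p n)           ≤⟨ ∑<-mono (suc (f p)) (λ _ → m≤m+n _ _) ⟩
    ∑< (suc (f p)) (childrenOfColour p (suc n))     ∎
    where open ≤-Reasoning
  ... | inj₁ child@(parent≡p , 1≤n) = begin
    children p n + 𝟙 (child? p n)                   ≡⟨ cong (children p n +_) (𝟙-yes (child? p n) child) ⟩
    children p n + 1                                ≡⟨ +-comm (children p n) 1 ⟩
    suc (children p n)                              ≤⟨ s≤s (children-≤-colours p n (<⇒≤ 1+n≤N)) ⟩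
    suc (∑< (suc (f p)) (childrenOfColour p n))     ≤⟨ ∑<-mono-< (suc (f p)) (λ _ → m≤m+n _ _) (s≤s c≤f) colour-new ⟩
    ∑< (suc (f p)) (childrenOfColour p (suc n))     ∎
    where
    open ≤-Reasoning
    c≤f : c p n ≤ f p
    c≤f = reg p n (subst (_< n) parent≡p (proj₂ (parent-spec 1≤n))) 1+n≤N
    colour-new : childrenOfColour p n (c p n) < childrenOfColour p (suc n) (c p n)
    colour-new = subst (childrenOfColour p n (c p n) <_)
                   (sym (cong (childrenOfColour p n (c p n) +_) (𝟙-yes (child? p n ×-dec (c p n ≟ c p n)) (child , refl))))
                   (≤-reflexive (+-comm 1 (childrenOfColour p n (c p n))))

  children-≤ : ∀ p n → n ≤ N → children p n ≤ suc (f p)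
  children-≤ p n n≤N = begin
    children p n                               ≤⟨ children-≤-colours p n n≤N ⟩
    ∑< (suc (f p)) (childrenOfColour p n)      ≤⟨ ∑<-mono (suc (f p)) (λ _ → childrenOfColour-≤1 p n _) ⟩
    ∑< (suc (f p)) (λ _ → 1)                   ≡⟨ ∑<-1 (suc (f p)) ⟩
    suc (f p)                                  ∎
    where open ≤-Reasoning

  slots : ℕ → ℕ → ℕ
  slots e n = ∑< n (λ p → 𝟙 (depth p ≟ e) * suc (f p))

  used : ℕ → ℕ → ℕ
  used e n = ∑< n (λ m → 𝟙 (depth m ≟ suc e))

  childrenAtDepth : ℕ → ℕ → ℕ
  childrenAtDepth e n = ∑< n (λ p → 𝟙 (depth p ≟ e) * children p n)

  childrenAtDepth-grows : ∀ e n → ∑< n (λ p → 𝟙 (depth p ≟ e) * children p n)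
                                ≤ ∑< n (λ p → 𝟙 (depth p ≟ e) * children p (suc n))
  childrenAtDepth-grows e n = ∑<-mono n (λ {p} _ → *-monoʳ-≤ (𝟙 (depth p ≟ e)) (m≤m+n (children p n) _))

  used-≤-childrenAtDepth : ∀ e n → used e n ≤ childrenAtDepth e n
  used-≤-childrenAtDepth e zero = z≤n
  used-≤-childrenAtDepth e (suc n) with toSum (depth n ≟ suc e)
  ... | inj₂ depth≢ = begin
    used e n + 𝟙 (depth n ≟ suc e)     ≡⟨ cong (used e n +_) (𝟙-no (depth n ≟ suc e) depth≢) ⟩
    used e n + 0                       ≡⟨ +-identityʳ _ ⟩
    used e n                           ≤⟨ used-≤-childrenAtDepth e n ⟩
    childrenAtDepth e n                ≤⟨ childrenAtDepth-grows e n ⟩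
    ∑< n (λ p → 𝟙 (depth p ≟ e) * children p (suc n)) ≤⟨ m≤m+n _ _ ⟩
    childrenAtDepth e (suc n)          ∎
    where open ≤-Reasoning
  ... | inj₁ depth≡ = begin
    used e n + 𝟙 (depth n ≟ suc e)     ≡⟨ cong (used e n +_) (𝟙-yes (depth n ≟ suc e) depth≡) ⟩
    used e n + 1                       ≡⟨ +-comm (used e n) 1 ⟩
    suc (used e n)                     ≤⟨ s≤s (used-≤-childrenAtDepth e n) ⟩
    suc (childrenAtDepth e n)          ≤⟨ ∑<-mono-< n (λ {p} _ → *-monoʳ-≤ (𝟙 (depth p ≟ e)) (m≤m+n (children p n) _))
                                                    (proj₂ (parent-spec 1≤n)) parent-term ⟩
    ∑< n (λ p → 𝟙 (depth p ≟ e) * children p (suc n)) ≤⟨ m≤m+n _ _ ⟩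
    childrenAtDepth e (suc n)          ∎
    where
    open ≤-Reasoning
    1≤n : 1 ≤ n
    1≤n = n≢0⇒n>0 (λ n≡0 → 0≢1+n (trans (cong depth (sym n≡0)) depth≡))
    q = parent n
    depth-q : depth q ≡ e
    depth-q = suc-injective (trans (sym (depth-parent 1≤n)) depth≡)
    parent-term : 𝟙 (depth q ≟ e) * children q n < 𝟙 (depth q ≟ e) * children q (suc n)
    parent-term rewrite 𝟙-yes (depth q ≟ e) depth-q | 𝟙-yes (child? q n) (refl , 1≤n) =
      subst₂ _<_ (sym (+-identityʳ _)) (sym (+-identityʳ _)) (subst (children q n <_) (+-comm 1 _) ≤-refl)

  used-≤-slots : ∀ e n → n ≤ N → used e n ≤ slots e n
  used-≤-slots e n n≤N = ≤-trans (used-≤-childrenAtDepth e n)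
    (∑<-mono n (λ {p} _ → *-monoʳ-≤ (𝟙 (depth p ≟ e)) (children-≤ p n n≤N)))

  slots-suc-≡ : ∀ {e m} → depth m ≡ e → slots e (suc m) ≡ slots e m + suc (f m)
  slots-suc-≡ {e} {m} eq = cong (slots e m +_) (trans (cong (_* suc (f m)) (𝟙-yes (depth m ≟ e) eq)) (+-identityʳ _))

  slots-suc-≢ : ∀ {e m} → depth m ≢ e → slots e (suc m) ≡ slots e m
  slots-suc-≢ {e} {m} ≢ = trans (cong (λ k → slots e m + k * suc (f m)) (𝟙-no (depth m ≟ e) ≢)) (+-identityʳ _)

  used-suc-≡ : ∀ {e m} → depth m ≡ suc e → used e (suc m) ≡ suc (used e m)
  used-suc-≡ {e} {m} eq = trans (cong (used e m +_) (𝟙-yes (depth m ≟ suc e) eq)) (+-comm _ 1)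

  used-suc-≢ : ∀ {e m} → depth m ≢ suc e → used e (suc m) ≡ used e m
  used-suc-≢ {e} {m} ≢ = trans (cong (used e m +_) (𝟙-no (depth m ≟ suc e) ≢)) (+-identityʳ _)

  module Play (h : ℕ) (shallow : ∀ {m} → m < N → depth m ≤ h) where
    open Budget f

    level : ℕ → Fin (suc h)
    level m with pred (depth m) <? suc h
    ... | yes d<1+h = Fin.fromℕ< d<1+h
    ... | no  _     = Fin.zero

    depth≡1+level : ∀ {m} → 1 ≤ m → m < N → depth m ≡ suc (toℕ (level m))
    depth≡1+level {m} 1≤m m<N with pred (depth m) <? suc h
    ... | yes d<1+h = trans (depth-parent 1≤m) (cong suc (sym (trans (toℕ-fromℕ< d<1+h) (cong pred (depth-parent 1≤m)))))
    ... | no  d≮1+h = ⊥-elim (d≮1+h (s≤s (≤-trans pred[n]≤n (shallow m<N))))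

    state : ℕ → Vec ℕ (suc h)
    state zero    = addHead (suc (f 0)) (Vec.replicate _ 0)
    state (suc n) = spend (level (suc n)) (suc (f (suc n))) (state n)

    state-lookup : ∀ n → suc n ≤ N → ∀ i → Vec.lookup (state n) i ≡ slots (toℕ i) (suc n) ∸ used (toℕ i) (suc n)
    state-lookup zero    _     Fin.zero    = refl
    state-lookup zero    _     (Fin.suc i) = lookup-replicate i 0
    state-lookup (suc n) 2+n≤N i with i Fin.≟ level (suc n) | toℕ i ≟ suc (toℕ (level (suc n)))
    ... | yes refl | _ = begin-equality
      Vec.lookup (state (suc n)) i            ≡⟨ lookup-spend-self i _ (state n) ⟩
      pred (Vec.lookup (state n) i)           ≡⟨ cong pred (state-lookup n (<⇒≤ 2+n≤N) i) ⟩
      pred (slots e (suc n) ∸ used e (suc n)) ≡⟨ pred[m∸n]≡m∸[1+n] (slots e (suc n)) _ ⟩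
      slots e (suc n) ∸ suc (used e (suc n))  ≡⟨ cong₂ _∸_ (slots-suc-≢ {e} {suc n} λ d≡e → 1+n≢n (trans (sym depth≡) d≡e))
                                                             (used-suc-≡ {e} {suc n} depth≡) ⟨
      slots e (2 + n) ∸ used e (2 + n)        ∎
      where
      open ≤-Reasoning
      e = toℕ i
      depth≡ : depth (suc n) ≡ suc e
      depth≡ = depth≡1+level (s≤s z≤n) 2+n≤N
    ... | no _ | yes i≡1+j = begin-equality
      Vec.lookup (state (suc n)) i            ≡⟨ lookup-spend-next (level (suc n)) i _ (state n) i≡1+j ⟩
      a + Vec.lookup (state n) i              ≡⟨ cong (a +_) (state-lookup n (<⇒≤ 2+n≤N) i) ⟩
      a + (slots e (suc n) ∸ used e (suc n))  ≡⟨ +-∸-assoc a (used-≤-slots e (suc n) (<⇒≤ 2+n≤N)) ⟨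
      a + slots e (suc n) ∸ used e (suc n)    ≡⟨ cong₂ _∸_ (trans (+-comm a _) (sym (slots-suc-≡ {e} {suc n} depth≡)))
                                                             (sym (used-suc-≢ {e} {suc n} λ d≡1+e → 1+n≢n (trans (sym d≡1+e) depth≡))) ⟩
      slots e (2 + n) ∸ used e (2 + n)        ∎
      where
      open ≤-Reasoning
      e = toℕ i
      a = suc (f (suc n))
      depth≡ : depth (suc n) ≡ e
      depth≡ = trans (depth≡1+level (s≤s z≤n) 2+n≤N) (sym i≡1+j)
    ... | no i≢j | no i≢1+j = begin-equality
      Vec.lookup (state (suc n)) i            ≡⟨ lookup-spend-other (level (suc n)) i _ (state n) (i≢j ∘ toℕ-injective) i≢1+j ⟩
      Vec.lookup (state n) i                  ≡⟨ state-lookup n (<⇒≤ 2+n≤N) i ⟩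
      slots e (suc n) ∸ used e (suc n)        ≡⟨ cong₂ _∸_ (slots-suc-≢ {e} {suc n} λ d≡e → i≢1+j (trans (sym d≡e) depth≡))
                                                             (used-suc-≢ {e} {suc n} λ d≡1+e → i≢j (toℕ-injective (suc-injective (trans (sym d≡1+e) depth≡)))) ⟨
      slots e (2 + n) ∸ used e (2 + n)        ∎
      where
      open ≤-Reasoning
      e = toℕ i
      depth≡ : depth (suc n) ≡ suc (toℕ (level (suc n)))
      depth≡ = depth≡1+level (s≤s z≤n) 2+n≤N

    slot-available : ∀ n → 2 + n ≤ N → 1 ≤ Vec.lookup (state n) (level (suc n))
    slot-available n 2+n≤N = subst (1 ≤_) (sym (state-lookup n (<⇒≤ 2+n≤N) j)) (m<n⇒0<n∸m used<slots)
      where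
      j = level (suc n)
      e = toℕ j
      depth≡ : depth (suc n) ≡ suc e
      depth≡ = depth≡1+level (s≤s z≤n) 2+n≤N
      used<slots : used e (suc n) < slots e (suc n)
      used<slots = subst₂ _≤_ (used-suc-≡ {e} {suc n} depth≡) (slots-suc-≢ {e} {suc n} λ d≡e → 1+n≢n (trans (sym depth≡) d≡e))
                     (used-≤-slots e (2 + n) 2+n≤N)

    budget-state : ∀ n → suc n ≤ N → budget (suc h) (λ _ n′ → n′) (state n) (suc n) ≤ budget (suc h) (λ _ n′ → n′) (state 0) 1
    budget-state zero    _     = ≤-refl
    budget-state (suc n) 2+n≤N = ≤-trans (budget-spend (suc h) _ (state n) (suc n) (level (suc n)) (slot-available n 2+n≤N))
                                         (budget-state n (<⇒≤ 2+n≤N))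

    time-≤-budget : ∀ {n} → suc n ≤ N → suc n ≤ budget (suc h) (λ _ n′ → n′) (state 0) 1
    time-≤-budget {n} 1+n≤N = ≤-trans (≤-trans (m≤m⊔n (suc n) (suc n)) (budget-≥ (suc h) _ (state n) (suc n)))
                                      (budget-state n 1+n≤N)

treeBound : (ℕ → ℕ) → ℕ → ℕ
treeBound f h = Budget.budget f (suc h) (λ _ n → n) (addHead (suc (f 0)) (Vec.replicate _ 0)) 1

minArrow-exists : ∀ f k → ∃ λ N → MinArrow N k f
minArrow-exists f zero          = 0 , λ _ _ → (λ ()) , (λ ()) , (λ ()) , (λ ())
minArrow-exists f (suc zero)    = 1 , λ _ _ → (λ _ → 0) , (λ _ → s≤s z≤n) , (λ { Fin.zero Fin.zero () })
                                            , (λ { Fin.zero Fin.zero _ () })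
minArrow-exists f (suc (suc h)) = suc (treeBound f h) , arrow
  where
  arrow : MinArrow (suc (treeBound f h)) (2 + h) f
  arrow c reg with anyUpTo? (λ n → suc h ≤? Chains.depth c n) (suc (treeBound f h))
  ... | yes (n , n<N , deep) = Chains.deep⇒minHomogeneous c n<N deep
  ... | no  ¬deep            = ⊥-elim (1+n≰n (Forest.Play.time-≤-budget f c _ reg h shallow ≤-refl))
    where
    shallow : ∀ {m} → m < suc (treeBound f h) → Chains.depth c m ≤ h
    shallow {m} m<N = ≤-pred (≰⇒> λ deep → ¬deep (m , m<N , deep))

-- Decidability of the arrow relation

Searchable : Set → Set₁
Searchable A = ∀ {P : A → Set} → (∀ x → Dec (P x)) → Dec (∃ P)

Vec-searchable : ∀ {A} → Searchable A → ∀ n → Searchable (Vec A n)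
Vec-searchable search zero    P? with P? []
... | yes p  = yes ([] , p)
... | no  ¬p = no λ { ([] , p) → ¬p p }
Vec-searchable search (suc n) P? with search (λ x → Vec-searchable search n (λ xs → P? (x ∷ xs)))
... | yes (x , xs , p) = yes (x ∷ xs , p)
... | no  ¬p           = no λ { (x ∷ xs , p) → ¬p (x , xs , p) }

searchable⇒∀? : ∀ {A} → Searchable A → ∀ {P : A → Set} → (∀ x → Dec (P x)) → Dec (∀ x → P x)
searchable⇒∀? search P? with search (λ x → ¬? (P? x))
... | yes (x , ¬px) = no λ ∀p → ¬px (∀p x)
... | no  ¬∃¬       = yes λ x → decidable-stable (P? x) λ ¬px → ¬∃¬ (x , ¬px)

minHomogeneous? : ∀ N c k b → Dec (MinHomogeneous N c k b)
minHomogeneous? N c k b =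
  all? (λ i → b i <? N) ×-dec
  all? (λ i → all? λ j → (i <ᶠ? j) →-dec (b i <? b j)) ×-dec
  all? (λ i → all? λ j → all? λ l → (i <ᶠ? j) →-dec ((i <ᶠ? l) →-dec (c (b i) (b j) ≟ c (b i) (b l))))

regressive? : ∀ f N c → Dec (Regressive f N c)
regressive? f N c = map′ (λ reg m n m<n n<N → reg {n} n<N {m} m<n) (λ reg {n} n<N {m} m<n → reg m n m<n n<N)
  (allUpTo? (λ n → allUpTo? (λ m → c m n ≤? f m) n) N)

MinHomogeneous-cong : ∀ {N c c′ k b b′} → (∀ {m n} → m < n → n < N → c m n ≡ c′ m n) → (∀ i → b i ≡ b′ i) →
                      MinHomogeneous N c k b → MinHomogeneous N c′ k b′
MinHomogeneous-cong {N} {c} {c′} {b = b} {b′} c≡c′ b≡b′ (below , increasing , min-colour) =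
  below′ , increasing′ , λ i j l i<j i<l → trans (sym (colour≡ i<j)) (trans (min-colour i j l i<j i<l) (colour≡ i<l))
  where
  below′ : ∀ i → b′ i < N
  below′ i = subst (_< N) (b≡b′ i) (below i)
  increasing′ : ∀ i j → i Fin.< j → b′ i < b′ j
  increasing′ i j i<j = subst₂ _<_ (b≡b′ i) (b≡b′ j) (increasing i j i<j)
  colour≡ : ∀ {i j} → i Fin.< j → c (b i) (b j) ≡ c′ (b′ i) (b′ j)
  colour≡ {i} {j} i<j = trans (cong₂ c (b≡b′ i) (b≡b′ j)) (c≡c′ (increasing′ i j i<j) (below′ j))

Fin-searchable : ∀ n → Searchable (Fin n)
Fin-searchable n = any?

minHomogeneous-exists? : ∀ N c k → Dec (∃ (MinHomogeneous N c k))
minHomogeneous-exists? N c k with Vec-searchable (Fin-searchable N) k (λ v → minHomogeneous? N c k (toℕ ∘ Vec.lookup v))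
... | yes (_ , hom) = yes (_ , hom)
... | no  ¬hom      = no λ (b , hom) → ¬hom (Vec.tabulate (λ i → Fin.fromℕ< (proj₁ hom i)) ,
    MinHomogeneous-cong {c = c} (λ _ _ → refl) (λ i → sym (trans (cong toℕ (lookup∘tabulate _ i)) (toℕ-fromℕ< _))) hom)

-- A regressive colouring of [M]² matters only through its values below M, which are bounded by
-- ∑< M f, so it can be replaced by a finite table.
module Tables (f : ℕ → ℕ) (M : ℕ) where

  Colour : Set
  Colour = Fin (suc (∑< M f))

  Table : Set
  Table = Vec (Vec Colour M) M

  colourOf : Table → ℕ → ℕ → ℕ
  colourOf T m n with m <? M | n <? M
  ... | yes m<M | yes n<M = toℕ (Vec.lookup (Vec.lookup T (Fin.fromℕ< m<M)) (Fin.fromℕ< n<M))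
  ... | _       | _       = 0

  entry : (c : ℕ → ℕ → ℕ) → Regressive f M c → Fin M → Fin M → Colour
  entry c reg m n with toℕ m <? toℕ n
  ... | yes m<n = Fin.fromℕ< (s≤s (≤-trans (reg _ _ m<n (toℕ<n n)) (≤-∑< f (toℕ<n m))))
  ... | no  _   = Fin.zero

  toℕ-entry : ∀ c reg {m n} → toℕ m < toℕ n → toℕ (entry c reg m n) ≡ c (toℕ m) (toℕ n)
  toℕ-entry c reg {m} {n} m<n with toℕ m <? toℕ n
  ... | yes _   = toℕ-fromℕ< _
  ... | no  m≮n = ⊥-elim (m≮n m<n)

  tableOf : (c : ℕ → ℕ → ℕ) → Regressive f M c → Table
  tableOf c reg = Vec.tabulate λ m → Vec.tabulate (entry c reg m)

  colourOf-tableOf : ∀ c reg {m n} → m < n → n < M → colourOf (tableOf c reg) m n ≡ c m n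
  colourOf-tableOf c reg {m} {n} m<n n<M with m <? M | n <? M
  ... | yes m<M | yes n<M = begin
    toℕ (Vec.lookup (Vec.lookup (tableOf c reg) m′) n′)  ≡⟨ cong (λ row → toℕ (Vec.lookup row n′)) (lookup∘tabulate _ m′) ⟩
    toℕ (Vec.lookup (Vec.tabulate (entry c reg m′)) n′)  ≡⟨ cong toℕ (lookup∘tabulate _ n′) ⟩
    toℕ (entry c reg m′ n′)                              ≡⟨ toℕ-entry c reg (subst₂ _<_ (sym (toℕ-fromℕ< m<M)) (sym (toℕ-fromℕ< n<M)) m<n) ⟩
    c (toℕ m′) (toℕ n′)                                  ≡⟨ cong₂ c (toℕ-fromℕ< m<M) (toℕ-fromℕ< n<M) ⟩
    c m n                                                ∎
    where
    open ≡-Reasoning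
    m′ = Fin.fromℕ< m<M
    n′ = Fin.fromℕ< n<M
  ... | yes _   | no n≮M = ⊥-elim (n≮M n<M)
  ... | no m≮M  | _      = ⊥-elim (m≮M (<-trans m<n n<M))

  minArrow? : ∀ k → Dec (MinArrow M k f)
  minArrow? k with searchable⇒∀? (Vec-searchable (Vec-searchable (Fin-searchable _) M) M)
                     (λ T → regressive? f M (colourOf T) →-dec minHomogeneous-exists? M (colourOf T) k)
  ... | no  ¬H = no λ arrow → ¬H λ T reg → arrow (colourOf T) reg
  ... | yes H  = yes λ c reg → let T≡c = colourOf-tableOf c reg in
    let (b , hom) = H (tableOf c reg) (λ m n m<n n<M → subst (_≤ f m) (sym (T≡c m<n n<M)) (reg m n m<n n<M)) in
    b , MinHomogeneous-cong T≡c (λ _ → refl) hom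

least : ∀ {P : ℕ → Set} → (∀ n → Dec (P n)) → ∀ v → (∃ λ n → n < v × P n) →
        ∃ λ N → P N × (∀ M → M < N → ¬ P M)
least P? (suc v) (n , n<1+v , Pn) with anyUpTo? P? v
... | yes below = least P? v below
... | no  ¬below = n , Pn , λ M M<n PM → ¬below (M , <-≤-trans M<n (≤-pred n<1+v) , PM)

ν-exists : ∀ f k → ∃ λ N → IsNu f k N
ν-exists f k with minArrow-exists f k
... | N₀ , arrow₀ with least (λ M → Tables.minArrow? f M k) (suc N₀) (N₀ , ≤-refl , arrow₀)
...   | N , arrow , minimal = N , arrow , minimal

mainTheorem3 : ∀ (t : ℕ) → 0 < t → (h : ℕ → ℕ) → PrimRec h →
    NuEventuallyDominates (g t) h
mainTheorem3 t 0<t h h-primRec with Growth.primRec-<-minArrow t 0<t h h-primRec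
... | K , h<N = K , λ k K≤k → let (N , isNu@(arrow , _)) = ν-exists (g t) k in N , isNu , h<N k K≤k N arrow
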